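{- Let $K$ be a subfield of $\mathbb{C}$ with $K \not\subseteq \mathbb{R}$, let $\mathcal{D}_0 = \{ z = x+yi \in K : x>0 \text{ and } y>0\}$, and let $SL_2(\mathbb{N}_0)$ be the semigroup of $2\times 2$ matrices with nonnegative integer entries and determinant $1$, acting on $\mathcal{D}_0$ by $\begin{pmatrix} a & b \\ c & d\end{pmatrix}(z) = \frac{az+b}{cz+d}$. Let $L,R \in SL_2(\mathbb{N}_0)$ be non-identity matrices such that $L(\mathcal{D}_0)\cap R(\mathcal{D}_0) = \emptyset$ (i.e., $(L,R)$ is a left-right pair). Then the subsemigroup $\langle L,R\rangle$ of $SL_2(\mathbb{N}_0)$ generated by $\{L,R\}$ is free (freely generated by $L$ and $R$).
   Context: A pair $(L,R)$ of non-identity matrices in $SL_2(\mathbb{N}_0)$ is called a left-right pair if $L(z_1)\neq R(z_2)$ for all $z_1,z_2\in\mathcal{D}_0$. -}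

module Defs where

open import Level using (0ℓ)
open import Data.Nat as ℕ using (ℕ; zero; suc)
open import Data.Product using (Σ; ∃; _×_; _,_)
open import Data.Sum using (_⊎_)
open import Data.Empty using (⊥)
open import Data.List.NonEmpty using (List⁺; _∷_)
open import Data.List using (List; []; _∷_)
open import Relation.Nullary using (¬_)
open import Relation.Binary.PropositionalEquality using (_≡_; _≢_)
open import Algebra.Structures using (IsCommutativeRing)

-- The real numbers, axiomatised as a complete ordered field
-- (Agda's stdlib has no ℝ; any structure satisfying these axioms is ℝ).

record RealField : Set₁ where
  field
    Carrier : Set
    0r 1r   : Carrier
    _+_ _*_ : Carrier → Carrier → Carrier
    -_      : Carrier → Carrier
    _⁻¹     : Carrier → Carrier
    _<_     : Carrier → Carrier → Set
    isCommutativeRing : IsCommutativeRing _≡_ _+_ _*_ -_ 0r 1r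
    0≢1     : 0r ≢ 1r
    ⁻¹-inverse : ∀ x → x ≢ 0r → x * (x ⁻¹) ≡ 1r
    <-irrefl : ∀ x → ¬ (x < x)
    <-trans  : ∀ {x y z} → x < y → y < z → x < z
    <-trichotomy : ∀ x y → (x < y) ⊎ (x ≡ y) ⊎ (y < x)
    +-mono-< : ∀ {x y} z → x < y → (x + z) < (y + z)
    *-pos    : ∀ {x y} → 0r < x → 0r < y → 0r < (x * y)
    complete : (P : Carrier → Set) → Σ Carrier P →
               Σ Carrier (λ b → ∀ x → P x → (x < b) ⊎ (x ≡ b)) →
               Σ Carrier (λ s → (∀ x → P x → (x < s) ⊎ (x ≡ s)) ×
                                (∀ b → (∀ x → P x → (x < b) ⊎ (x ≡ b)) → (s < b) ⊎ (s ≡ b)))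

module Complex (ℝ : RealField) where
  open RealField ℝ renaming (Carrier to R)

  record ℂ : Set where
    constructor _+i_
    field
      re im : R
  open ℂ public

  _-r_ : R → R → R
  x -r y = x + (- y)

  0ℂ 1ℂ : ℂ
  0ℂ = 0r +i 0r
  1ℂ = 1r +i 0r

  _+ℂ_ _*ℂ_ : ℂ → ℂ → ℂ
  (a +i b) +ℂ (c +i d) = (a + c) +i (b + d)
  (a +i b) *ℂ (c +i d) = ((a * c) -r (b * d)) +i ((a * d) + (b * c))

  -ℂ_ : ℂ → ℂ
  -ℂ (a +i b) = (- a) +i (- b)

  -- multiplicative inverse (the value at 0 is irrelevant)
  invℂ : ℂ → ℂ
  invℂ (a +i b) = (a * n) +i ((- b) * n)
    where n = ((a * a) + (b * b)) ⁻¹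

  _/ℂ_ : ℂ → ℂ → ℂ
  z /ℂ w = z *ℂ invℂ w

  fromℕ : ℕ → ℂ
  fromℕ zero    = 0ℂ
  fromℕ (suc n) = 1ℂ +ℂ fromℕ n

  record Subfield : Set₁ where
    field
      mem   : ℂ → Set
      0∈    : mem 0ℂ
      1∈    : mem 1ℂ
      +∈    : ∀ {z w} → mem z → mem w → mem (z +ℂ w)
      -∈    : ∀ {z} → mem z → mem (-ℂ z)
      *∈    : ∀ {z w} → mem z → mem w → mem (z *ℂ w)
      inv∈  : ∀ {z} → mem z → z ≢ 0ℂ → mem (invℂ z)
  open Subfield public

  NotReal : Subfield → Set
  NotReal K = Σ ℂ (λ z → mem K z × im z ≢ 0r)

  D₀ : Subfield → ℂ → Set
  D₀ K z = mem K z × (0r < re z) × (0r < im z)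

record Mat : Set where
  constructor mat
  field
    a b c d : ℕ
open Mat public

SL2N0 : Mat → Set
SL2N0 M = a M ℕ.* d M ≡ b M ℕ.* c M ℕ.+ 1

I₂ : Mat
I₂ = mat 1 0 0 1

_·_ : Mat → Mat → Mat
mat a₁ b₁ c₁ d₁ · mat a₂ b₂ c₂ d₂ =
  mat (a₁ ℕ.* a₂ ℕ.+ b₁ ℕ.* c₂) (a₁ ℕ.* b₂ ℕ.+ b₁ ℕ.* d₂)
      (c₁ ℕ.* a₂ ℕ.+ d₁ ℕ.* c₂) (c₁ ℕ.* b₂ ℕ.+ d₁ ℕ.* d₂)

module Action (ℝ : RealField) where
  open Complex ℝ

  act : Mat → ℂ → ℂ
  act M z = ((fromℕ (a M) *ℂ z) +ℂ fromℕ (b M)) /ℂ ((fromℕ (c M) *ℂ z) +ℂ fromℕ (d M))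

  LeftRightPair : Subfield → Mat → Mat → Set
  LeftRightPair K L R =
    L ≢ I₂ × R ≢ I₂ ×
    (∀ z₁ z₂ → D₀ K z₁ → D₀ K z₂ → act L z₁ ≢ act R z₂)

data Gen : Set where
  gL gR : Gen

evalWord : Mat → Mat → List⁺ Gen → Mat
evalWord L R (g ∷ gs) = go g gs
  where
    val : Gen → Mat
    val gL = L
    val gR = R
    go : Gen → List Gen → Mat
    go g []        = val g
    go g (h ∷ hs)  = val g · go h hs

FreelyGenerated : Mat → Mat → Set
FreelyGenerated L R = ∀ w w' → evalWord L R w ≡ evalWord L R w' → w ≡ w'

{-# OPTIONS --safe #-}
-- Every M ∈ SL₂(ℕ₀) maps 𝒟₀ into itself, 𝒟₀ is nonempty because K ⊄ ℝ, and on a point z of 𝒟₀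
-- M ↦ M(z) turns matrix products into composition. Hence L·X = R·Y with X, Y ∈ SL₂(ℕ₀) would give
-- L(X(z)) = R(Y(z)), against the left-right property. Two words with the same value therefore
-- begin with the same letter; as SL₂(ℕ₀) is left-cancellative and a product of non-identity
-- factors is never the identity, the words can be peeled letter by letter until both are empty.
module Submission where

open import Defs
open import Level using (0ℓ)
open import Algebra.Bundles using (CommutativeRing)
open import Data.Nat as ℕ using (ℕ; zero; suc)
import Data.Nat.Properties as ℕ
open import Data.Integer as ℤ using (ℤ; +_; -[1+_]; _⊖_; sign; ∣_∣; _◃_)
import Data.Integer.Properties as ℤ
open import Data.Sign as Sign using (Sign)
open import Data.Maybe using (Maybe; map)
open import Data.List using (List; []; _∷_)
open import Data.List.NonEmpty using (_∷_; toList)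
open import Data.Product using (Σ; _×_; _,_; proj₁; proj₂)
open import Data.Sum using (_⊎_; inj₁; inj₂)
open import Data.Empty using (⊥-elim)
open import Function using (_∘_)
open import Relation.Nullary.Decidable using (dec⇒maybe)
open import Relation.Binary.PropositionalEquality as ≡ using (_≡_; _≢_)

module _ where
  open ≡
  open import Data.Nat using (_+_; _*_)
  open import Data.Nat.Tactic.RingSolver using (solve-∀)

  -- det (A · B) = det A · det B, with the negative terms of both sides exchanged.
  binet-cauchy : ∀ a₁ b₁ c₁ d₁ a₂ b₂ c₂ d₂ →
    (a₁ * a₂ + b₁ * c₂) * (c₁ * b₂ + d₁ * d₂) + ((a₁ * d₁) * (b₂ * c₂) + (b₁ * c₁) * (a₂ * d₂))
      ≡ (a₁ * b₂ + b₁ * d₂) * (c₁ * a₂ + d₁ * c₂) + ((a₁ * d₁) * (a₂ * d₂) + (b₁ * c₁) * (b₂ * c₂))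
  binet-cauchy = solve-∀

  SL2N0-· : ∀ A B → SL2N0 A → SL2N0 B → SL2N0 (A · B)
  SL2N0-· (mat a₁ b₁ c₁ d₁) (mat a₂ b₂ c₂ d₂) det₁ det₂ = ℕ.+-cancelʳ-≡ ((p + 1) * q + p * (q + 1)) _ _ (begin
    X + ((p + 1) * q + p * (q + 1))            ≡⟨ cong₂ (λ s t → X + (s * q + p * t)) det₁ det₂ ⟨
    X + ((a₁ * d₁) * q + p * (a₂ * d₂))        ≡⟨ binet-cauchy a₁ b₁ c₁ d₁ a₂ b₂ c₂ d₂ ⟩
    Y + ((a₁ * d₁) * (a₂ * d₂) + p * q)        ≡⟨ cong₂ (λ s t → Y + (s * t + p * q)) det₁ det₂ ⟩
    Y + ((p + 1) * (q + 1) + p * q)            ≡⟨ regroup Y p q ⟩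
    Y + 1 + ((p + 1) * q + p * (q + 1))        ∎)
    where
    open ≡-Reasoning
    p = b₁ * c₁
    q = b₂ * c₂
    X = (a₁ * a₂ + b₁ * c₂) * (c₁ * b₂ + d₁ * d₂)
    Y = (a₁ * b₂ + b₁ * d₂) * (c₁ * a₂ + d₁ * c₂)
    regroup : ∀ y p q → y + ((p + 1) * (q + 1) + p * q) ≡ y + 1 + ((p + 1) * q + p * (q + 1))
    regroup = solve-∀

  -- Multiplication by the adjugate of M, with the negative terms moved across.
  adjugate-row₁ : ∀ a b c d → SL2N0 (mat a b c d) → ∀ x y → d * (a * x + b * y) ≡ b * (c * x + d * y) + x
  adjugate-row₁ a b c d det x y = begin
    d * (a * x + b * y)             ≡⟨ expand a b d x y ⟩
    (a * d) * x + b * (d * y)       ≡⟨ cong (λ t → t * x + b * (d * y)) det ⟩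
    (b * c + 1) * x + b * (d * y)   ≡⟨ collect b c d x y ⟩
    b * (c * x + d * y) + x         ∎
    where
    open ≡-Reasoning
    expand : ∀ a b d x y → d * (a * x + b * y) ≡ (a * d) * x + b * (d * y)
    expand = solve-∀
    collect : ∀ b c d x y → (b * c + 1) * x + b * (d * y) ≡ b * (c * x + d * y) + x
    collect = solve-∀

  adjugate-row₂ : ∀ a b c d → SL2N0 (mat a b c d) → ∀ x y → a * (c * x + d * y) ≡ c * (a * x + b * y) + y
  adjugate-row₂ a b c d det x y = begin
    a * (c * x + d * y)             ≡⟨ expand a c d x y ⟩
    c * (a * x) + (a * d) * y       ≡⟨ cong (λ t → c * (a * x) + t * y) det ⟩
    c * (a * x) + (b * c + 1) * y   ≡⟨ collect a b c x y ⟩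
    c * (a * x + b * y) + y         ∎
    where
    open ≡-Reasoning
    expand : ∀ a c d x y → a * (c * x + d * y) ≡ c * (a * x) + (a * d) * y
    expand = solve-∀
    collect : ∀ a b c x y → c * (a * x) + (b * c + 1) * y ≡ c * (a * x + b * y) + y
    collect = solve-∀

  column-determined : ∀ a b c d → SL2N0 (mat a b c d) → ∀ x y x′ y′ →
                      a * x + b * y ≡ a * x′ + b * y′ → c * x + d * y ≡ c * x′ + d * y′ → x ≡ x′ × y ≡ y′
  column-determined a b c d det x y x′ y′ top bottom =
    ℕ.+-cancelˡ-≡ (b * (c * x′ + d * y′)) x x′ (begin
      b * (c * x′ + d * y′) + x     ≡⟨ cong (λ t → b * t + x) bottom ⟨
      b * (c * x + d * y) + x       ≡⟨ adjugate-row₁ a b c d det x y ⟨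
      d * (a * x + b * y)           ≡⟨ cong (d *_) top ⟩
      d * (a * x′ + b * y′)         ≡⟨ adjugate-row₁ a b c d det x′ y′ ⟩
      b * (c * x′ + d * y′) + x′    ∎) ,
    ℕ.+-cancelˡ-≡ (c * (a * x′ + b * y′)) y y′ (begin
      c * (a * x′ + b * y′) + y     ≡⟨ cong (λ t → c * t + y) top ⟨
      c * (a * x + b * y) + y       ≡⟨ adjugate-row₂ a b c d det x y ⟨
      a * (c * x + d * y)           ≡⟨ cong (a *_) bottom ⟩
      a * (c * x′ + d * y′)         ≡⟨ adjugate-row₂ a b c d det x′ y′ ⟩
      c * (a * x′ + b * y′) + y′    ∎)
    where open ≡-Reasoning

  mat-≡ : ∀ {a₁ b₁ c₁ d₁ a₂ b₂ c₂ d₂} → a₁ ≡ a₂ → b₁ ≡ b₂ → c₁ ≡ c₂ → d₁ ≡ d₂ → mat a₁ b₁ c₁ d₁ ≡ mat a₂ b₂ c₂ d₂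
  mat-≡ refl refl refl refl = refl

  ·-cancelˡ : ∀ M A B → SL2N0 M → M · A ≡ M · B → A ≡ B
  ·-cancelˡ (mat a b c d) (mat a₁ b₁ c₁ d₁) (mat a₂ b₂ c₂ d₂) det MA≡MB =
    mat-≡ a₁≡a₂ b₁≡b₂ c₁≡c₂ d₁≡d₂
    where
    first  = column-determined a b c d det a₁ c₁ a₂ c₂ (cong Mat.a MA≡MB) (cong Mat.c MA≡MB)
    second = column-determined a b c d det b₁ d₁ b₂ d₂ (cong Mat.b MA≡MB) (cong Mat.d MA≡MB)
    a₁≡a₂ = proj₁ first
    c₁≡c₂ = proj₂ first
    b₁≡b₂ = proj₁ second
    d₁≡d₂ = proj₂ second

  A·B≡I₂⇒A≡I₂ : ∀ A B → SL2N0 A → A · B ≡ I₂ → A ≡ I₂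
  A·B≡I₂⇒A≡I₂ (mat a b c d) (mat p q r s) det AB≡I =
    mat-≡ (ℕ.m*n≡1⇒m≡1 a d ad≡1) b≡0 c≡0 (ℕ.m*n≡1⇒n≡1 a d ad≡1)
    where
    open ≡-Reasoning
    b≡0 : b ≡ 0
    b≡0 = ℕ.m+n≡0⇒m≡0 b (begin
      b + q                      ≡⟨ cong (_+ q) (ℕ.*-identityʳ b) ⟨
      b * 1 + q                  ≡⟨ cong (λ t → b * t + q) (cong Mat.d AB≡I) ⟨
      b * (c * q + d * s) + q    ≡⟨ adjugate-row₁ a b c d det q s ⟨
      d * (a * q + b * s)        ≡⟨ cong (d *_) (cong Mat.b AB≡I) ⟩
      d * 0                      ≡⟨ ℕ.*-zeroʳ d ⟩
      0                          ∎)
    c≡0 : c ≡ 0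
    c≡0 = ℕ.m+n≡0⇒m≡0 c (begin
      c + r                      ≡⟨ cong (_+ r) (ℕ.*-identityʳ c) ⟨
      c * 1 + r                  ≡⟨ cong (λ t → c * t + r) (cong Mat.a AB≡I) ⟨
      c * (a * p + b * r) + r    ≡⟨ adjugate-row₂ a b c d det p r ⟨
      a * (c * p + d * r)        ≡⟨ cong (a *_) (cong Mat.c AB≡I) ⟩
      a * 0                      ≡⟨ ℕ.*-zeroʳ a ⟩
      0                          ∎)
    ad≡1 : a * d ≡ 1
    ad≡1 = trans det (cong (λ t → t * c + 1) b≡0)

  ·-identityʳ : ∀ M → M · I₂ ≡ M
  ·-identityʳ (mat a b c d) = mat-≡ (first a b) (second a b) (first c d) (second c d)
    where
    first : ∀ x y → x * 1 + y * 0 ≡ x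
    first = solve-∀
    second : ∀ x y → x * 0 + y * 1 ≡ y
    second = solve-∀

-- Coefficients are integers, so that constants such as (-1)·(-1) normalise by computation even
-- though the ring itself has no decidable equality.
module IntegerCoefficientRingSolver {c ℓ} (R : CommutativeRing c ℓ) where
  open CommutativeRing R
  open import Algebra.Properties.Ring ring using (-‿distribˡ-*; -‿distribʳ-*; -0#≈0#; -‿involutive)
  open import Algebra.Properties.AbelianGroup +-abelianGroup using (⁻¹-∙-comm)
  open import Algebra.Properties.Semiring.Mult.TCOptimised semiring using (1+×; ×-homo-+; ×1-homo-*)
    renaming (_×_ to _×′_)
  open import Relation.Binary.Reasoning.Setoid setoid

  fromℤ : ℤ → Carrier
  fromℤ (+ n)    = n ×′ 1#
  fromℤ -[1+ n ] = - (suc n ×′ 1#)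

  signed : Sign → Carrier → Carrier
  signed Sign.+ x = x
  signed Sign.- x = - x

  signed-cong : ∀ s {x y} → x ≈ y → signed s x ≈ signed s y
  signed-cong Sign.+ x≈y = x≈y
  signed-cong Sign.- x≈y = -‿cong x≈y

  signed-* : ∀ s t x y → signed (s Sign.* t) (x * y) ≈ signed s x * signed t y
  signed-* Sign.+ Sign.+ x y = refl
  signed-* Sign.+ Sign.- x y = -‿distribʳ-* x y
  signed-* Sign.- Sign.+ x y = -‿distribˡ-* x y
  signed-* Sign.- Sign.- x y = begin
    x * y           ≈⟨ -‿involutive (x * y) ⟨
    - - (x * y)     ≈⟨ -‿cong (-‿distribˡ-* x y) ⟩
    - (- x * y)     ≈⟨ -‿distribʳ-* (- x) y ⟩
    - x * - y       ∎

  fromℤ-◃ : ∀ s n → fromℤ (s ◃ n) ≈ signed s (n ×′ 1#)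
  fromℤ-◃ Sign.+ zero    = refl
  fromℤ-◃ Sign.- zero    = sym -0#≈0#
  fromℤ-◃ Sign.+ (suc n) = refl
  fromℤ-◃ Sign.- (suc n) = refl

  fromℤ-signed : ∀ i → fromℤ i ≈ signed (sign i) (∣ i ∣ ×′ 1#)
  fromℤ-signed (+ n)    = refl
  fromℤ-signed -[1+ n ] = refl

  fromℤ-* : ∀ i j → fromℤ (i ℤ.* j) ≈ fromℤ i * fromℤ j
  fromℤ-* i j = begin
    fromℤ (s ◃ ∣ i ∣ ℕ.* ∣ j ∣)                                  ≈⟨ fromℤ-◃ s (∣ i ∣ ℕ.* ∣ j ∣) ⟩
    signed s ((∣ i ∣ ℕ.* ∣ j ∣) ×′ 1#)                             ≈⟨ signed-cong s (×1-homo-* ∣ i ∣ ∣ j ∣) ⟩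
    signed s ((∣ i ∣ ×′ 1#) * (∣ j ∣ ×′ 1#))                        ≈⟨ signed-* (sign i) (sign j) (∣ i ∣ ×′ 1#) (∣ j ∣ ×′ 1#) ⟩
    signed (sign i) (∣ i ∣ ×′ 1#) * signed (sign j) (∣ j ∣ ×′ 1#)   ≈⟨ *-cong (fromℤ-signed i) (fromℤ-signed j) ⟨
    fromℤ i * fromℤ j                                               ∎
    where s = sign i Sign.* sign j

  fromℤ-neg : ∀ i → fromℤ (ℤ.- i) ≈ - fromℤ i
  fromℤ-neg (+ zero)    = sym -0#≈0#
  fromℤ-neg (+ (suc n)) = refl
  fromℤ-neg -[1+ n ]    = sym (-‿involutive _)

  1+x-[1+y]≈x-y : ∀ x y → (1# + x) - (1# + y) ≈ x - y
  1+x-[1+y]≈x-y x y = begin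
    (1# + x) + - (1# + y)     ≈⟨ +-congˡ (⁻¹-∙-comm 1# y) ⟨
    (1# + x) + (- 1# + - y)   ≈⟨ +-assoc 1# x _ ⟩
    1# + (x + (- 1# + - y))   ≈⟨ +-congˡ (+-assoc x _ _) ⟨
    1# + ((x + - 1#) + - y)   ≈⟨ +-congˡ (+-congʳ (+-comm x _)) ⟩
    1# + ((- 1# + x) + - y)   ≈⟨ +-congˡ (+-assoc _ x _) ⟩
    1# + (- 1# + (x + - y))   ≈⟨ +-assoc 1# _ _ ⟨
    (1# + - 1#) + (x + - y)   ≈⟨ +-congʳ (-‿inverseʳ 1#) ⟩
    0# + (x + - y)            ≈⟨ +-identityˡ _ ⟩
    x - y                     ∎

  fromℤ-⊖ : ∀ m n → fromℤ (m ⊖ n) ≈ m ×′ 1# - n ×′ 1#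
  fromℤ-⊖ zero    zero    = sym (trans (+-congˡ -0#≈0#) (+-identityʳ 0#))
  fromℤ-⊖ (suc m) zero    = sym (trans (+-congˡ -0#≈0#) (+-identityʳ _))
  fromℤ-⊖ zero    (suc n) = sym (+-identityˡ _)
  fromℤ-⊖ (suc m) (suc n) = begin
    fromℤ (suc m ⊖ suc n)              ≡⟨ ≡.cong fromℤ (ℤ.[1+m]⊖[1+n]≡m⊖n m n) ⟩
    fromℤ (m ⊖ n)                      ≈⟨ fromℤ-⊖ m n ⟩
    m ×′ 1# - n ×′ 1#                  ≈⟨ 1+x-[1+y]≈x-y (m ×′ 1#) (n ×′ 1#) ⟨
    (1# + m ×′ 1#) - (1# + n ×′ 1#)    ≈⟨ +-cong (1+× m 1#) (-‿cong (1+× n 1#)) ⟨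
    suc m ×′ 1# - suc n ×′ 1#          ∎

  fromℤ-+ : ∀ i j → fromℤ (i ℤ.+ j) ≈ fromℤ i + fromℤ j
  fromℤ-+ (+ m)    (+ n)    = ×-homo-+ 1# m n
  fromℤ-+ (+ m)    -[1+ n ] = fromℤ-⊖ m (suc n)
  fromℤ-+ -[1+ m ] (+ n)    = trans (fromℤ-⊖ n (suc m)) (+-comm _ _)
  fromℤ-+ -[1+ m ] -[1+ n ] = begin
    - (suc (suc (m ℕ.+ n)) ×′ 1#)        ≡⟨ ≡.cong (λ k → - (suc k ×′ 1#)) (ℕ.+-suc m n) ⟨
    - ((suc m ℕ.+ suc n) ×′ 1#)          ≈⟨ -‿cong (×-homo-+ 1# (suc m) (suc n)) ⟩
    - (suc m ×′ 1# + suc n ×′ 1#)        ≈⟨ ⁻¹-∙-comm (suc m ×′ 1#) (suc n ×′ 1#) ⟨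
    - (suc m ×′ 1#) + - (suc n ×′ 1#)    ∎

  open import Algebra.Solver.Ring.AlmostCommutativeRing
    using (fromCommutativeRing; _-Raw-AlmostCommutative⟶_)

  fromℤ-morphism : ℤ.+-*-rawRing -Raw-AlmostCommutative⟶ fromCommutativeRing R
  fromℤ-morphism = record
    { ⟦_⟧    = fromℤ
    ; +-homo = fromℤ-+
    ; *-homo = fromℤ-*
    ; -‿homo = fromℤ-neg
    ; 0-homo = refl
    ; 1-homo = refl
    }

  fromℤ-≈? : ∀ i j → Maybe (fromℤ i ≈ fromℤ j)
  fromℤ-≈? i j = map (λ { ≡.refl → refl }) (dec⇒maybe (i ℤ.≟ j))

  open import Algebra.Solver.Ring ℤ.+-*-rawRing (fromCommutativeRing R) fromℤ-morphism fromℤ-≈? public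

module OrderedFieldProperties (ℝ : RealField) where
  open ≡
  open RealField ℝ public using (0≢1; ⁻¹-inverse; <-irrefl; <-trans; <-trichotomy; +-mono-<; *-pos)
  open RealField ℝ using (_⁻¹; isCommutativeRing)

  commutativeRing : CommutativeRing 0ℓ 0ℓ
  commutativeRing = record { isCommutativeRing = isCommutativeRing }

  open CommutativeRing commutativeRing public hiding (_≈_; refl; sym; trans; zero)
  open import Algebra.Properties.Ring ring public using (-‿distribʳ-*; -0#≈0#)
  open import Algebra.Properties.Semiring.Mult.TCOptimised semiring using (1+×; ×-homo-+; ×1-homo-*)
    renaming (_×_ to _×′_)
  open IntegerCoefficientRingSolver commutativeRing public using (solve; _:=_; _:+_; _:*_; _:-_; :-_; con)

  infix 4 _<_ _≤_
  _<_ : Carrier → Carrier → Set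
  _<_ = RealField._<_ ℝ

  _≤_ : Carrier → Carrier → Set
  x ≤ y = x < y ⊎ x ≡ y

  <⇒≢ : ∀ {x y} → x < y → y ≢ x
  <⇒≢ {x} x<y refl = <-irrefl x x<y

  +-mono-<-≤ : ∀ {x y} → 0# < x → 0# ≤ y → 0# < x + y
  +-mono-<-≤ {x} 0<x (inj₂ refl) = subst (0# <_) (sym (+-identityʳ x)) 0<x
  +-mono-<-≤ {x} {y} 0<x (inj₁ 0<y) = <-trans 0<y (subst (_< x + y) (+-identityˡ y) (+-mono-< y 0<x))

  +-mono-≤-< : ∀ {x y} → 0# ≤ x → 0# < y → 0# < x + y
  +-mono-≤-< {x} {y} 0≤x 0<y = subst (0# <_) (+-comm y x) (+-mono-<-≤ 0<y 0≤x)

  +-mono-≤ : ∀ {x y} → 0# ≤ x → 0# ≤ y → 0# ≤ x + y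
  +-mono-≤ (inj₁ 0<x) 0≤y = inj₁ (+-mono-<-≤ 0<x 0≤y)
  +-mono-≤ {y = y} (inj₂ refl) 0≤y = subst (0# ≤_) (sym (+-identityˡ y)) 0≤y

  *-mono-≤ : ∀ {x y} → 0# ≤ x → 0# ≤ y → 0# ≤ x * y
  *-mono-≤ (inj₁ 0<x) (inj₁ 0<y) = inj₁ (*-pos 0<x 0<y)
  *-mono-≤ {x} _ (inj₂ refl) = inj₂ (sym (zeroʳ x))
  *-mono-≤ {y = y} (inj₂ refl) _ = inj₂ (sym (zeroˡ y))

  neg-pos : ∀ {x} → x < 0# → 0# < - x
  neg-pos {x} x<0 = subst₂ _<_ (-‿inverseʳ x) (+-identityˡ (- x)) (+-mono-< (- x) x<0)

  -x*-x≡x*x : ∀ x → - x * - x ≡ x * x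
  -x*-x≡x*x = solve 1 (λ x → :- x :* :- x := x :* x) refl

  0<x*x : ∀ {x} → x ≢ 0# → 0# < x * x
  0<x*x {x} x≢0 with <-trichotomy 0# x
  ... | inj₁ 0<x        = *-pos 0<x 0<x
  ... | inj₂ (inj₁ 0≡x) = ⊥-elim (x≢0 (sym 0≡x))
  ... | inj₂ (inj₂ x<0) = subst (0# <_) (-x*-x≡x*x x) (*-pos (neg-pos x<0) (neg-pos x<0))

  0≤x*x : ∀ x → 0# ≤ x * x
  0≤x*x x with <-trichotomy 0# x
  ... | inj₂ (inj₁ refl) = inj₂ (sym (zeroˡ 0#))
  ... | inj₁ 0<x         = inj₁ (0<x*x (<⇒≢ 0<x))
  ... | inj₂ (inj₂ x<0)  = inj₁ (0<x*x (<⇒≢ x<0 ∘ sym))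

  0<1 : 0# < 1#
  0<1 = subst (0# <_) (*-identityˡ 1#) (0<x*x (0≢1 ∘ sym))

  0<x⇒0<x⁻¹ : ∀ {x} → 0# < x → 0# < x ⁻¹
  0<x⇒0<x⁻¹ {x} 0<x with <-trichotomy 0# (x ⁻¹)
  ... | inj₁ 0<x⁻¹ = 0<x⁻¹
  ... | inj₂ (inj₁ 0≡x⁻¹) = ⊥-elim (0≢1 (begin
      0#          ≡⟨ zeroʳ x ⟨
      x * 0#      ≡⟨ cong (x *_) 0≡x⁻¹ ⟩
      x * x ⁻¹    ≡⟨ ⁻¹-inverse x (<⇒≢ 0<x) ⟩
      1#          ∎))
    where open ≡-Reasoning
  ... | inj₂ (inj₂ x⁻¹<0) = ⊥-elim (<-irrefl 0# (<-trans 0<-1 -1<0))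
    where
    0<-1 : 0# < - 1#
    0<-1 = subst (0# <_) (trans (sym (-‿distribʳ-* x (x ⁻¹))) (cong -_ (⁻¹-inverse x (<⇒≢ 0<x)))) (*-pos 0<x (neg-pos x⁻¹<0))
    -1<0 : - 1# < 0#
    -1<0 = subst₂ _<_ (+-identityˡ (- 1#)) (-‿inverseʳ 1#) (+-mono-< (- 1#) 0<1)

  ι : ℕ → Carrier
  ι n = n ×′ 1#

  ι-suc : ∀ n → ι (suc n) ≡ 1# + ι n
  ι-suc n = 1+× n 1#

  ι-+ : ∀ m n → ι (m ℕ.+ n) ≡ ι m + ι n
  ι-+ = ×-homo-+ 1#

  ι-* : ∀ m n → ι (m ℕ.* n) ≡ ι m * ι n
  ι-* = ×1-homo-*

  0<ι[1+n] : ∀ n → 0# < ι (suc n)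
  0≤ι : ∀ n → 0# ≤ ι n
  0<ι[1+n] n = subst (0# <_) (sym (ι-suc n)) (+-mono-<-≤ 0<1 (0≤ι n))
  0≤ι zero    = inj₂ refl
  0≤ι (suc n) = inj₁ (0<ι[1+n] n)

module ComplexFieldProperties (ℝ : RealField) where
  open ≡
  open OrderedFieldProperties ℝ public
  open Complex ℝ public
  open RealField ℝ using (_⁻¹)
  open IntegerCoefficientRingSolver commutativeRing using (Polynomial)

  ℂPoly : ℕ → Set
  ℂPoly n = Polynomial n × Polynomial n

  _:+ℂ_ _:*ℂ_ : ∀ {n} → ℂPoly n → ℂPoly n → ℂPoly n
  (p , q) :+ℂ (r , s) = p :+ r , q :+ s
  (p , q) :*ℂ (r , s) = p :* r :- q :* s , p :* s :+ q :* r

  :ℝ : ∀ {n} → Polynomial n → ℂPoly n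
  :ℝ p = p , con (+ 0)

  *ℂ-assoc : ∀ u v w → (u *ℂ v) *ℂ w ≡ u *ℂ (v *ℂ w)
  *ℂ-assoc (a +i b) (c +i d) (e +i f) = cong₂ _+i_
    (solve 6 (λ a b c d e f → proj₁ (((a , b) :*ℂ (c , d)) :*ℂ (e , f)) := proj₁ ((a , b) :*ℂ ((c , d) :*ℂ (e , f)))) refl a b c d e f)
    (solve 6 (λ a b c d e f → proj₂ (((a , b) :*ℂ (c , d)) :*ℂ (e , f)) := proj₂ ((a , b) :*ℂ ((c , d) :*ℂ (e , f)))) refl a b c d e f)

  *ℂ-comm : ∀ u v → u *ℂ v ≡ v *ℂ u
  *ℂ-comm (a +i b) (c +i d) = cong₂ _+i_
    (solve 4 (λ a b c d → proj₁ ((a , b) :*ℂ (c , d)) := proj₁ ((c , d) :*ℂ (a , b))) refl a b c d)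
    (solve 4 (λ a b c d → proj₂ ((a , b) :*ℂ (c , d)) := proj₂ ((c , d) :*ℂ (a , b))) refl a b c d)

  *ℂ-interchange : ∀ u v w x → (u *ℂ v) *ℂ (w *ℂ x) ≡ (u *ℂ w) *ℂ (v *ℂ x)
  *ℂ-interchange (a +i b) (c +i d) (e +i f) (g +i h) = cong₂ _+i_
    (solve 8 (λ a b c d e f g h → proj₁ (((a , b) :*ℂ (c , d)) :*ℂ ((e , f) :*ℂ (g , h)))
                                := proj₁ (((a , b) :*ℂ (e , f)) :*ℂ ((c , d) :*ℂ (g , h)))) refl a b c d e f g h)
    (solve 8 (λ a b c d e f g h → proj₂ (((a , b) :*ℂ (c , d)) :*ℂ ((e , f) :*ℂ (g , h)))
                                := proj₂ (((a , b) :*ℂ (e , f)) :*ℂ ((c , d) :*ℂ (g , h)))) refl a b c d e f g h)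

  *ℂ-distribʳ : ∀ u v w → (u +ℂ v) *ℂ w ≡ (u *ℂ w) +ℂ (v *ℂ w)
  *ℂ-distribʳ (a +i b) (c +i d) (e +i f) = cong₂ _+i_
    (solve 6 (λ a b c d e f → proj₁ (((a , b) :+ℂ (c , d)) :*ℂ (e , f)) := proj₁ (((a , b) :*ℂ (e , f)) :+ℂ ((c , d) :*ℂ (e , f)))) refl a b c d e f)
    (solve 6 (λ a b c d e f → proj₂ (((a , b) :+ℂ (c , d)) :*ℂ (e , f)) := proj₂ (((a , b) :*ℂ (e , f)) :+ℂ ((c , d) :*ℂ (e , f)))) refl a b c d e f)

  *ℂ-identityʳ : ∀ u → u *ℂ 1ℂ ≡ u
  *ℂ-identityʳ (a +i b) = cong₂ _+i_
    (solve 2 (λ a b → proj₁ ((a , b) :*ℂ :ℝ (con (+ 1))) := a) refl a b)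
    (solve 2 (λ a b → proj₂ ((a , b) :*ℂ :ℝ (con (+ 1))) := b) refl a b)

  *ℂ-zeroˡ : ∀ u → 0ℂ *ℂ u ≡ 0ℂ
  *ℂ-zeroˡ (a +i b) = cong₂ _+i_
    (solve 2 (λ a b → proj₁ (:ℝ (con (+ 0)) :*ℂ (a , b)) := con (+ 0)) refl a b)
    (solve 2 (λ a b → proj₂ (:ℝ (con (+ 0)) :*ℂ (a , b)) := con (+ 0)) refl a b)

  0<re²+im² : ∀ z → z ≢ 0ℂ → 0# < re z * re z + im z * im z
  0<re²+im² (x +i y) z≢0 with <-trichotomy 0# x
  ... | inj₁ 0<x        = +-mono-<-≤ (0<x*x (<⇒≢ 0<x)) (0≤x*x y)
  ... | inj₂ (inj₂ x<0) = +-mono-<-≤ (0<x*x (<⇒≢ x<0 ∘ sym)) (0≤x*x y)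
  ... | inj₂ (inj₁ refl) with <-trichotomy 0# y
  ...   | inj₁ 0<y        = +-mono-≤-< (0≤x*x 0#) (0<x*x (<⇒≢ 0<y))
  ...   | inj₂ (inj₂ y<0) = +-mono-≤-< (0≤x*x 0#) (0<x*x (<⇒≢ y<0 ∘ sym))
  ...   | inj₂ (inj₁ refl) = ⊥-elim (z≢0 refl)

  *ℂ-invℂ : ∀ z → z ≢ 0ℂ → z *ℂ invℂ z ≡ 1ℂ
  *ℂ-invℂ (x +i y) z≢0 = cong₂ _+i_
    (trans (solve 3 (λ x y n → x :* (x :* n) :- y :* (:- y :* n) := (x :* x :+ y :* y) :* n) refl x y n)
           (⁻¹-inverse (x * x + y * y) (<⇒≢ (0<re²+im² (x +i y) z≢0))))
    (solve 3 (λ x y n → x :* (:- y :* n) :+ y :* (x :* n) := con (+ 0)) refl x y n)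
    where n = (x * x + y * y) ⁻¹

  invℂ-unique : ∀ u v → u *ℂ v ≡ 1ℂ → invℂ u ≡ v
  invℂ-unique u v uv≡1 = begin
    invℂ u                 ≡⟨ *ℂ-identityʳ (invℂ u) ⟨
    invℂ u *ℂ 1ℂ           ≡⟨ cong (invℂ u *ℂ_) uv≡1 ⟨
    invℂ u *ℂ (u *ℂ v)     ≡⟨ *ℂ-assoc (invℂ u) u v ⟨
    (invℂ u *ℂ u) *ℂ v     ≡⟨ cong (_*ℂ v) (trans (*ℂ-comm (invℂ u) u) (*ℂ-invℂ u u≢0)) ⟩
    1ℂ *ℂ v                ≡⟨ *ℂ-comm 1ℂ v ⟩
    v *ℂ 1ℂ                ≡⟨ *ℂ-identityʳ v ⟩
    v                      ∎
    where
    open ≡-Reasoning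
    u≢0 : u ≢ 0ℂ
    u≢0 refl = 0≢1 (cong re (trans (sym (*ℂ-zeroˡ v)) uv≡1))

  fromℕ≡ι : ∀ n → fromℕ n ≡ ι n +i 0#
  fromℕ≡ι zero    = refl
  fromℕ≡ι (suc n) = trans (cong (1ℂ +ℂ_) (fromℕ≡ι n)) (cong₂ _+i_ (sym (ι-suc n)) (+-identityˡ 0#))

module MöbiusAction (ℝ : RealField) where
  open ≡
  open ComplexFieldProperties ℝ
  open Action ℝ
  open RealField ℝ using (_⁻¹)

  num den : Mat → ℂ → ℂ
  num M z = (fromℕ (a M) *ℂ z) +ℂ fromℕ (b M)
  den M z = (fromℕ (c M) *ℂ z) +ℂ fromℕ (d M)

  fromℕ-row : ∀ p r a₂ b₂ c₂ d₂ z →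
    (fromℕ (p ℕ.* a₂ ℕ.+ r ℕ.* c₂) *ℂ z) +ℂ fromℕ (p ℕ.* b₂ ℕ.+ r ℕ.* d₂)
      ≡ (fromℕ p *ℂ ((fromℕ a₂ *ℂ z) +ℂ fromℕ b₂)) +ℂ (fromℕ r *ℂ ((fromℕ c₂ *ℂ z) +ℂ fromℕ d₂))
  fromℕ-row p r a₂ b₂ c₂ d₂ (x +i y)
    rewrite fromℕ≡ι (p ℕ.* a₂ ℕ.+ r ℕ.* c₂) | fromℕ≡ι (p ℕ.* b₂ ℕ.+ r ℕ.* d₂)
          | ι-+ (p ℕ.* a₂) (r ℕ.* c₂) | ι-+ (p ℕ.* b₂) (r ℕ.* d₂)
          | ι-* p a₂ | ι-* r c₂ | ι-* p b₂ | ι-* r d₂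
          | fromℕ≡ι p | fromℕ≡ι r | fromℕ≡ι a₂ | fromℕ≡ι b₂ | fromℕ≡ι c₂ | fromℕ≡ι d₂
    = cong₂ _+i_
      (solve 8 (λ p r a b c d x y → proj₁ ((:ℝ (p :* a :+ r :* c) :*ℂ (x , y)) :+ℂ :ℝ (p :* b :+ r :* d))
                  := proj₁ ((:ℝ p :*ℂ ((:ℝ a :*ℂ (x , y)) :+ℂ :ℝ b)) :+ℂ (:ℝ r :*ℂ ((:ℝ c :*ℂ (x , y)) :+ℂ :ℝ d)))) refl
               (ι p) (ι r) (ι a₂) (ι b₂) (ι c₂) (ι d₂) x y)
      (solve 8 (λ p r a b c d x y → proj₂ ((:ℝ (p :* a :+ r :* c) :*ℂ (x , y)) :+ℂ :ℝ (p :* b :+ r :* d))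
                  := proj₂ ((:ℝ p :*ℂ ((:ℝ a :*ℂ (x , y)) :+ℂ :ℝ b)) :+ℂ (:ℝ r :*ℂ ((:ℝ c :*ℂ (x , y)) :+ℂ :ℝ d)))) refl
               (ι p) (ι r) (ι a₂) (ι b₂) (ι c₂) (ι d₂) x y)

  num-· : ∀ A B z → num (A · B) z ≡ (fromℕ (a A) *ℂ num B z) +ℂ (fromℕ (b A) *ℂ den B z)
  num-· (mat a₁ b₁ _ _) (mat a₂ b₂ c₂ d₂) = fromℕ-row a₁ b₁ a₂ b₂ c₂ d₂

  den-· : ∀ A B z → den (A · B) z ≡ (fromℕ (c A) *ℂ num B z) +ℂ (fromℕ (d A) *ℂ den B z)
  den-· (mat _ _ c₁ d₁) (mat a₂ b₂ c₂ d₂) = fromℕ-row c₁ d₁ a₂ b₂ c₂ d₂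

  affine-/ℂ : ∀ α β n e → e ≢ 0ℂ → (α *ℂ (n /ℂ e)) +ℂ β ≡ ((α *ℂ n) +ℂ (β *ℂ e)) /ℂ e
  affine-/ℂ α β n e e≢0 = begin
    (α *ℂ (n *ℂ invℂ e)) +ℂ β                        ≡⟨ cong₂ _+ℂ_ (*ℂ-assoc α n (invℂ e)) (*ℂ-identityʳ β) ⟨
    ((α *ℂ n) *ℂ invℂ e) +ℂ (β *ℂ 1ℂ)                ≡⟨ cong (λ t → ((α *ℂ n) *ℂ invℂ e) +ℂ (β *ℂ t)) (*ℂ-invℂ e e≢0) ⟨
    ((α *ℂ n) *ℂ invℂ e) +ℂ (β *ℂ (e *ℂ invℂ e))     ≡⟨ cong (((α *ℂ n) *ℂ invℂ e) +ℂ_) (*ℂ-assoc β e (invℂ e)) ⟨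
    ((α *ℂ n) *ℂ invℂ e) +ℂ ((β *ℂ e) *ℂ invℂ e)     ≡⟨ *ℂ-distribʳ (α *ℂ n) (β *ℂ e) (invℂ e) ⟨
    ((α *ℂ n) +ℂ (β *ℂ e)) *ℂ invℂ e                 ∎
    where open ≡-Reasoning

  /ℂ-cancel-invℂ : ∀ p q e → q ≢ 0ℂ → e ≢ 0ℂ → (p *ℂ invℂ e) /ℂ (q *ℂ invℂ e) ≡ p /ℂ q
  /ℂ-cancel-invℂ p q e q≢0 e≢0 = begin
    (p *ℂ invℂ e) *ℂ invℂ (q *ℂ invℂ e)   ≡⟨ cong ((p *ℂ invℂ e) *ℂ_) inv[q/e] ⟩
    (p *ℂ invℂ e) *ℂ (invℂ q *ℂ e)        ≡⟨ *ℂ-interchange p (invℂ e) (invℂ q) e ⟩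
    (p *ℂ invℂ q) *ℂ (invℂ e *ℂ e)        ≡⟨ cong ((p *ℂ invℂ q) *ℂ_) e⁻¹e≡1 ⟩
    (p *ℂ invℂ q) *ℂ 1ℂ                   ≡⟨ *ℂ-identityʳ (p *ℂ invℂ q) ⟩
    p *ℂ invℂ q                           ∎
    where
    open ≡-Reasoning
    e⁻¹e≡1 : invℂ e *ℂ e ≡ 1ℂ
    e⁻¹e≡1 = trans (*ℂ-comm (invℂ e) e) (*ℂ-invℂ e e≢0)
    inv[q/e] : invℂ (q *ℂ invℂ e) ≡ invℂ q *ℂ e
    inv[q/e] = invℂ-unique (q *ℂ invℂ e) (invℂ q *ℂ e) (begin
      (q *ℂ invℂ e) *ℂ (invℂ q *ℂ e)      ≡⟨ *ℂ-interchange q (invℂ e) (invℂ q) e ⟩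
      (q *ℂ invℂ q) *ℂ (invℂ e *ℂ e)      ≡⟨ cong₂ _*ℂ_ (*ℂ-invℂ q q≢0) e⁻¹e≡1 ⟩
      1ℂ *ℂ 1ℂ                            ≡⟨ *ℂ-identityʳ 1ℂ ⟩
      1ℂ                                  ∎)

  act-· : ∀ A B z → den B z ≢ 0ℂ → den (A · B) z ≢ 0ℂ → act (A · B) z ≡ act A (act B z)
  act-· A B z D≢0 AB≢0 = begin
    num (A · B) z /ℂ den (A · B) z          ≡⟨ cong₂ _/ℂ_ (num-· A B z) (den-· A B z) ⟩
    P /ℂ Q                                  ≡⟨ /ℂ-cancel-invℂ P Q D Q≢0 D≢0 ⟨
    (P /ℂ D) /ℂ (Q /ℂ D)                    ≡⟨ cong₂ _/ℂ_ (affine-/ℂ α β N D D≢0) (affine-/ℂ γ δ N D D≢0) ⟨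
    act A (act B z)                         ∎
    where
    open ≡-Reasoning
    α = fromℕ (a A); β = fromℕ (b A); γ = fromℕ (c A); δ = fromℕ (d A)
    N = num B z; D = den B z
    P = (α *ℂ N) +ℂ (β *ℂ D)
    Q = (γ *ℂ N) +ℂ (δ *ℂ D)
    Q≢0 : Q ≢ 0ℂ
    Q≢0 Q≡0 = AB≢0 (trans (den-· A B z) Q≡0)

  fromℕ-affine : ∀ p q x y → (fromℕ p *ℂ (x +i y)) +ℂ fromℕ q ≡ (ι p * x + ι q) +i (ι p * y)
  fromℕ-affine p q x y rewrite fromℕ≡ι p | fromℕ≡ι q = cong₂ _+i_
    (solve 4 (λ p q x y → proj₁ ((:ℝ p :*ℂ (x , y)) :+ℂ :ℝ q) := p :* x :+ q) refl (ι p) (ι q) x y)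
    (solve 4 (λ p q x y → proj₂ ((:ℝ p :*ℂ (x , y)) :+ℂ :ℝ q) := p :* y) refl (ι p) (ι q) x y)

  ι-det : ∀ M → SL2N0 M → ι (a M) * ι (d M) ≡ ι (b M) * ι (c M) + 1#
  ι-det (mat a b c d) det = begin
    ι a * ι d              ≡⟨ ι-* a d ⟨
    ι (a ℕ.* d)            ≡⟨ cong ι det ⟩
    ι (b ℕ.* c ℕ.+ 1)      ≡⟨ ι-+ (b ℕ.* c) 1 ⟩
    ι (b ℕ.* c) + 1#       ≡⟨ cong (_+ 1#) (ι-* b c) ⟩
    ι b * ι c + 1#         ∎
    where open ≡-Reasoning

  0<re-den : ∀ M x → SL2N0 M → 0# < x → 0# < ι (c M) * x + ι (d M)
  0<re-den (mat a b (suc c) d) x det 0<x = +-mono-<-≤ (*-pos (0<ι[1+n] c) 0<x) (0≤ι d)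
  0<re-den (mat a b zero (suc d)) x det 0<x = +-mono-≤-< (*-mono-≤ (0≤ι zero) (inj₁ 0<x)) (0<ι[1+n] d)
  0<re-den (mat a b zero zero) x det 0<x
    with () ← trans (sym (ℕ.*-zeroʳ a)) (trans det (cong (ℕ._+ 1) (ℕ.*-zeroʳ b)))

  den≢0 : ∀ M z → SL2N0 M → 0# < re z → den M z ≢ 0ℂ
  den≢0 M (x +i y) det 0<x den≡0 =
    <⇒≢ (0<re-den M x det 0<x) (cong re (trans (sym (fromℕ-affine (c M) (d M) x y)) den≡0))

  -- Im M(z) = Im z · det M / |cz + d|², and Re M(z) has only nonnegative terms.
  act-upper : ∀ M x y → SL2N0 M → 0# < x → 0# < y →
              0# < re (act M (x +i y)) × 0# < im (act M (x +i y))
  act-upper M@(mat a b c d) x y det 0<x 0<y =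
    subst (λ w → 0# < re w) (sym act≡) (subst (0# <_) (sym re≡) (*-pos 0<E 0<m)) ,
    subst (λ w → 0# < im w) (sym act≡) (subst (0# <_) (sym im≡) (*-pos 0<y 0<m))
    where
    α = ι a; β = ι b; γ = ι c; δ = ι d
    r = γ * x + δ
    s = γ * y
    m = (r * r + s * s) ⁻¹
    0<m : 0# < m
    0<m = 0<x⇒0<x⁻¹ (+-mono-<-≤ (*-pos 0<r 0<r) (0≤x*x s))
      where 0<r = 0<re-den M x det 0<x
    act≡ : act M (x +i y) ≡ ((α * x + β) +i (α * y)) *ℂ invℂ (r +i s)
    act≡ = cong₂ (λ n e → n *ℂ invℂ e) (fromℕ-affine a b x y) (fromℕ-affine c d x y)
    E = α * γ * (x * x + y * y) + (α * δ + β * γ) * x + β * δ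
    re≡ : re (((α * x + β) +i (α * y)) *ℂ invℂ (r +i s)) ≡ E * m
    re≡ = solve 7 (λ α β γ δ x y m → proj₁ ((α :* x :+ β , α :* y) :*ℂ ((γ :* x :+ δ) :* m , :- (γ :* y) :* m))
                    := (α :* γ :* (x :* x :+ y :* y) :+ (α :* δ :+ β :* γ) :* x :+ β :* δ) :* m) refl α β γ δ x y m
    im≡ : im (((α * x + β) +i (α * y)) *ℂ invℂ (r +i s)) ≡ y * m
    im≡ = begin
      im (((α * x + β) +i (α * y)) *ℂ invℂ (r +i s))
        ≡⟨ solve 7 (λ α β γ δ x y m → proj₂ ((α :* x :+ β , α :* y) :*ℂ ((γ :* x :+ δ) :* m , :- (γ :* y) :* m))
                     := y :* m :* (α :* δ :- β :* γ)) refl α β γ δ x y m ⟩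
      y * m * (α * δ - β * γ)      ≡⟨ cong (λ t → y * m * (t - β * γ)) (ι-det M det) ⟩
      y * m * (β * γ + 1# - β * γ) ≡⟨ solve 3 (λ y m t → y :* m :* (t :+ con (+ 1) :- t) := y :* m) refl y m (β * γ) ⟩
      y * m                        ∎
      where open ≡-Reasoning
    0≤βγ : 0# ≤ β * γ
    0≤βγ = *-mono-≤ (0≤ι b) (0≤ι c)
    0<αδ+βγ : 0# < α * δ + β * γ
    0<αδ+βγ = +-mono-<-≤ (subst (0# <_) (sym (ι-det M det)) (+-mono-≤-< 0≤βγ 0<1)) 0≤βγ
    0<E : 0# < E
    0<E = +-mono-<-≤ (+-mono-≤-< (*-mono-≤ (*-mono-≤ (0≤ι a) (0≤ι c)) (+-mono-≤ (0≤x*x x) (0≤x*x y)))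
                                 (*-pos 0<αδ+βγ 0<x))
                     (*-mono-≤ (0≤ι b) (0≤ι d))

  fromℕ∈ : ∀ K n → mem K (fromℕ n)
  fromℕ∈ K zero    = 0∈ K
  fromℕ∈ K (suc n) = +∈ K (1∈ K) (fromℕ∈ K n)

  act∈ : ∀ K M z → mem K z → den M z ≢ 0ℂ → mem K (act M z)
  act∈ K M z z∈K den≢0 =
    *∈ K (+∈ K (*∈ K (fromℕ∈ K (a M)) z∈K) (fromℕ∈ K (b M)))
         (inv∈ K (+∈ K (*∈ K (fromℕ∈ K (c M)) z∈K) (fromℕ∈ K (d M))) den≢0)

  act-D₀ : ∀ K M z → SL2N0 M → D₀ K z → D₀ K (act M z)
  act-D₀ K M z@(x +i y) det (z∈K , 0<x , 0<y) =
    act∈ K M z z∈K (den≢0 M z det 0<x) , act-upper M x y det 0<x 0<y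

  upperHalf-inhabited : ∀ K → NotReal K → Σ ℂ (λ w → mem K w × 0# < im w)
  upperHalf-inhabited K (z , z∈K , im≢0) with <-trichotomy 0# (im z)
  ... | inj₁ 0<im        = z , z∈K , 0<im
  ... | inj₂ (inj₁ 0≡im) = ⊥-elim (im≢0 (sym 0≡im))
  ... | inj₂ (inj₂ im<0) = -ℂ z , -∈ K z∈K , neg-pos im<0

  -- A point of the upper half plane is moved into the first quadrant by z ↦ z + 1 or z ↦ -1/z.
  D₀-inhabited : ∀ K → NotReal K → Σ ℂ (D₀ K)
  D₀-inhabited K notReal with upperHalf-inhabited K notReal
  ... | w@(x +i y) , w∈K , 0<y with <-trichotomy 0# x
  ...   | inj₁ 0<x        = w , w∈K , 0<x , 0<y
  ...   | inj₂ (inj₁ refl) = w +ℂ 1ℂ , +∈ K w∈K (1∈ K) ,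
                             subst (0# <_) (sym (+-identityˡ 1#)) 0<1 , subst (0# <_) (sym (+-identityʳ y)) 0<y
  ...   | inj₂ (inj₂ x<0) = -ℂ invℂ w , -∈ K (inv∈ K w∈K w≢0) ,
            subst (0# <_) (solve 2 (λ x m → :- x :* m := :- (x :* m)) refl x m) (*-pos (neg-pos x<0) 0<m) ,
            subst (0# <_) (solve 2 (λ y m → y :* m := :- (:- y :* m)) refl y m) (*-pos 0<y 0<m)
    where
    w≢0 : w ≢ 0ℂ
    w≢0 w≡0 = <⇒≢ 0<y (cong im w≡0)
    m = (x * x + y * y) ⁻¹
    0<m : 0# < m
    0<m = 0<x⇒0<x⁻¹ (0<re²+im² w w≢0)

  L·X≢R·Y : ∀ K → NotReal K → ∀ L R → SL2N0 L → SL2N0 R →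
            (∀ z₁ z₂ → D₀ K z₁ → D₀ K z₂ → act L z₁ ≢ act R z₂) →
            ∀ X Y → SL2N0 X → SL2N0 Y → L · X ≢ R · Y
  L·X≢R·Y K notReal L R L∈SL R∈SL disjoint X Y X∈SL Y∈SL L·X≡R·Y =
    disjoint (act X z) (act Y z) (act-D₀ K X z X∈SL z∈D₀) (act-D₀ K Y z Y∈SL z∈D₀) (begin
      act L (act X z)   ≡⟨ act-· L X z (den≢0 X z X∈SL 0<re) (den≢0 (L · X) z LX∈SL 0<re) ⟨
      act (L · X) z     ≡⟨ cong (λ M → act M z) L·X≡R·Y ⟩
      act (R · Y) z     ≡⟨ act-· R Y z (den≢0 Y z Y∈SL 0<re) (den≢0 (R · Y) z RY∈SL 0<re) ⟩
      act R (act Y z)   ∎)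
    where
    open ≡-Reasoning
    z = proj₁ (D₀-inhabited K notReal)
    z∈D₀ = proj₂ (D₀-inhabited K notReal)
    0<re = proj₁ (proj₂ z∈D₀)
    LX∈SL = SL2N0-· L X L∈SL X∈SL
    RY∈SL = SL2N0-· R Y R∈SL Y∈SL

module _ {L R : Mat} (L∈SL : SL2N0 L) (R∈SL : SL2N0 R) (L≢I₂ : L ≢ I₂) (R≢I₂ : R ≢ I₂)
         (L·X≢R·Y : ∀ X Y → SL2N0 X → SL2N0 Y → L · X ≢ R · Y) where
  open ≡

  generator : Gen → Mat
  generator gL = L
  generator gR = R

  generator∈SL : ∀ g → SL2N0 (generator g)
  generator∈SL gL = L∈SL
  generator∈SL gR = R∈SL

  generator≢I₂ : ∀ g → generator g ≢ I₂
  generator≢I₂ gL = L≢I₂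
  generator≢I₂ gR = R≢I₂

  evalTail : List Gen → Mat
  evalTail []       = I₂
  evalTail (h ∷ hs) = evalWord L R (h ∷ hs)

  evalWord-∷ : ∀ g gs → evalWord L R (g ∷ gs) ≡ generator g · evalTail gs
  evalWord-∷ gL []       = sym (·-identityʳ L)
  evalWord-∷ gR []       = sym (·-identityʳ R)
  evalWord-∷ gL (_ ∷ _)  = refl
  evalWord-∷ gR (_ ∷ _)  = refl

  evalWord∈SL : ∀ g gs → SL2N0 (evalWord L R (g ∷ gs))
  evalTail∈SL : ∀ gs → SL2N0 (evalTail gs)
  evalWord∈SL g gs = subst SL2N0 (sym (evalWord-∷ g gs))
                       (SL2N0-· (generator g) (evalTail gs) (generator∈SL g) (evalTail∈SL gs))
  evalTail∈SL []       = refl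
  evalTail∈SL (h ∷ hs) = evalWord∈SL h hs

  evalWord≢I₂ : ∀ g gs → evalWord L R (g ∷ gs) ≢ I₂
  evalWord≢I₂ g gs eval≡I₂ = generator≢I₂ g
    (A·B≡I₂⇒A≡I₂ (generator g) (evalTail gs) (generator∈SL g) (trans (sym (evalWord-∷ g gs)) eval≡I₂))

  evalTail-cancel : ∀ g gs hs → evalWord L R (g ∷ gs) ≡ evalWord L R (g ∷ hs) → evalTail gs ≡ evalTail hs
  evalTail-cancel g gs hs eq = ·-cancelˡ (generator g) (evalTail gs) (evalTail hs) (generator∈SL g)
    (trans (sym (evalWord-∷ g gs)) (trans eq (evalWord-∷ g hs)))

  evalWord-gL≢gR : ∀ gs hs → evalWord L R (gL ∷ gs) ≢ evalWord L R (gR ∷ hs)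
  evalWord-gL≢gR gs hs eq = L·X≢R·Y (evalTail gs) (evalTail hs) (evalTail∈SL gs) (evalTail∈SL hs)
    (trans (sym (evalWord-∷ gL gs)) (trans eq (evalWord-∷ gR hs)))

  evalWord-injective : ∀ g gs h hs → evalWord L R (g ∷ gs) ≡ evalWord L R (h ∷ hs) → g ∷ gs ≡ h ∷ hs
  evalTail-injective : ∀ gs hs → evalTail gs ≡ evalTail hs → gs ≡ hs

  evalWord-injective gL gs gL hs eq = cong (gL ∷_) (evalTail-injective gs hs (evalTail-cancel gL gs hs eq))
  evalWord-injective gR gs gR hs eq = cong (gR ∷_) (evalTail-injective gs hs (evalTail-cancel gR gs hs eq))
  evalWord-injective gL gs gR hs eq = ⊥-elim (evalWord-gL≢gR gs hs eq)
  evalWord-injective gR gs gL hs eq = ⊥-elim (evalWord-gL≢gR hs gs (sym eq))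

  evalTail-injective []       []       _  = refl
  evalTail-injective []       (m ∷ ms) eq = ⊥-elim (evalWord≢I₂ m ms (sym eq))
  evalTail-injective (k ∷ ks) []       eq = ⊥-elim (evalWord≢I₂ k ks eq)
  evalTail-injective (k ∷ ks) (m ∷ ms) eq = cong toList (evalWord-injective k ks m ms eq)

  freelyGenerated : FreelyGenerated L R
  freelyGenerated (g ∷ gs) (h ∷ hs) = evalWord-injective g gs h hs

mainTheorem3 : (ℝ : RealField) → (K : Complex.Subfield ℝ) → Complex.NotReal ℝ K →
               (L R : Mat) → SL2N0 L → SL2N0 R →
               Action.LeftRightPair ℝ K L R → FreelyGenerated L R
mainTheorem3 ℝ K notReal L R L∈SL R∈SL (L≢I₂ , R≢I₂ , disjoint) =
  freelyGenerated L∈SL R∈SL L≢I₂ R≢I₂ (L·X≢R·Y K notReal L R L∈SL R∈SL disjoint)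
  where open MöbiusAction ℝ
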